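{- Let $G$ be an infinite bipartite dHp graph with sides $A$ and $B$, both infinite. If every vertex of $A$ has finite degree, then $A$ is countable. Consequently, if in addition $G$ is connected, then $B$ is also countable.
   Context: For $X\subseteq V(G)$ with $|X|\ge 2$, $N^2(X)$ denotes the set of vertices of $G$ having at least two neighbours in $X$. A bipartite graph $G$ with sides $A$ and $B$ is a dHp graph if $|A|\ge 2$ and $|N^2(X)|\ge |X|$ for every $X\subseteq A$ with $|X|\ge 2$. -}

module Defs where

open import Data.Bool using (Bool; true)
open import Data.Nat using (ℕ)
open import Data.Empty using (⊥)
open import Data.Product using (Σ; _×_; proj₁)
open import Data.Sum using (_⊎_; inj₁; inj₂)
open import Data.List using (List)
open import Data.List.Membership.Propositional using (_∈_)
open import Relation.Nullary using (¬_)
open import Relation.Binary.PropositionalEquality using (_≡_)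
open import Relation.Binary.Construct.Closure.ReflexiveTransitive using (Star)

-- A bipartite graph with sides A and B: vertex set A ⊎ B, edges only
-- between A and B, given by a Bool-valued adjacency E a b (simple graph).
record BipGraph : Set₁ where
  field
    A : Set
    B : Set
    E : A → B → Bool

Subset : Set → Set
Subset T = T → Bool

Elem : {T : Set} → Subset T → Set
Elem {T} X = Σ T (λ t → X t ≡ true)

FiniteType : Set → Set
FiniteType T = Σ (List T) (λ l → (t : T) → t ∈ l)

InfiniteType : Set → Set
InfiniteType T = ¬ FiniteType T

Countable : Set → Set
Countable T = Σ (T → ℕ) (λ f → ∀ x y → f x ≡ f y → x ≡ y)

AtLeastTwo : {T : Set} → Subset T → Set
AtLeastTwo {T} X = Σ T (λ x → Σ T (λ y → ¬ (x ≡ y) × (X x ≡ true) × (X y ≡ true)))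

module _ (G : BipGraph) where
  open BipGraph G

  InN2 : Subset A → B → Set
  InN2 X b = Σ A (λ x → Σ A (λ y → ¬ (x ≡ y) × (X x ≡ true) × (X y ≡ true)
                                 × (E x b ≡ true) × (E y b ≡ true)))

  -- |N²(X)| ≥ |X| : there is an injection from X into N²(X) ⊆ B.
  N2CardGe : Subset A → Set
  N2CardGe X = Σ (Elem X → B) (λ f →
                 ((x y : Elem X) → f x ≡ f y → proj₁ x ≡ proj₁ y)
                 × ((x : Elem X) → InN2 X (f x)))

  IsDHp : Set
  IsDHp = AtLeastTwo {A} (λ _ → true) × ((X : Subset A) → AtLeastTwo X → N2CardGe X)

  FiniteDegree : A → Set
  FiniteDegree a = Σ (List B) (λ l → (b : B) → E a b ≡ true → b ∈ l)

  Adj : A ⊎ B → A ⊎ B → Set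
  Adj (inj₁ a) (inj₂ b) = E a b ≡ true
  Adj (inj₂ b) (inj₁ a) = E a b ≡ true
  Adj _ _ = ⊥

  Connected : Set
  Connected = (u v : A ⊎ B) → Star Adj u v

{-# OPTIONS --safe #-}
module Submission where

-- Suppose A is uncountable. Since degrees are finite, some uncountable F ⊆ A
-- has all degrees below some n. Starting from R = ∅, as long as some b ∉ R has
-- uncountably many neighbours in F, replace F by those neighbours and add b
-- to R; every member of F then has fewer neighbours outside R than before, so
-- this stops after fewer than n steps. At that point every b ∉ R has only
-- countably many neighbours in F, and a greedy choice yields, for every m, m
-- vertices of F whose pairwise common neighbours lie in the finite set R. For
-- m = |R| + 2 these form a set X with N²(X) ⊆ R, contradicting |N²(X)| ≥ |X|.
-- If G is connected, every b ∈ B has a neighbour a and is determined by a and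
-- its position in the finite list of neighbours of a, so B is countable too.

open import Defs
open import Level using (0ℓ)
open import Axiom.ExcludedMiddle using (ExcludedMiddle)
open import Data.Bool using (Bool; true; false; if_then_else_)
open import Data.Empty using (⊥)
open import Data.Fin using (Fin; zero; suc; toℕ)
open import Data.Fin.Properties using (0≢1+n; toℕ-injective; injective⇒≤)
open import Data.List using (List; []; _∷_; length; lookup)
open import Data.List.Membership.Propositional using (_∈_; _∉_)
open import Data.List.Relation.Unary.Any using (here; there; index)
open import Data.List.Relation.Unary.Any.Properties using (lookup-index)
open import Data.Nat using (ℕ; zero; suc; _+_; _≤_; _<_; z≤n; s≤s)
open import Data.Nat.Properties
  using (+-identityʳ; +-suc; ≤-refl; ≤-pred; <-≤-trans; m≤n⇒m≤1+n; m+n≤o⇒n≤o; 1+n≰n; n≮0)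
open import Data.Product using (Σ; ∃; _×_; _,_; proj₁; proj₂; map)
open import Data.Product.Properties using (,-injectiveˡ; ,-injectiveʳ)
open import Data.Sum using (_⊎_; inj₁; inj₂)
open import Data.Vec.Functional using (Vector) renaming ([] to []ᵛ; _∷_ to _∷ᵛ_)
open import Function using (id; _∘_; flip)
open import Function.Definitions using (Injective)
open import Relation.Binary.PropositionalEquality
  using (_≡_; _≢_; refl; sym; trans; cong; subst; module ≡-Reasoning)
open import Relation.Binary.Construct.Closure.ReflexiveTransitive using (_◅_)
open import Relation.Nullary using (¬_; Dec; yes; no; does; contradiction)
open import Relation.Nullary.Decidable using (dec-true; decidable-stable)

-- Cantor's enumeration of ℕ × ℕ along the diagonals m + n = s.
next : ℕ × ℕ → ℕ × ℕ
next (m , suc n) = suc m , n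
next (m , zero)  = zero , suc m

unpair : ℕ → ℕ × ℕ
unpair zero    = zero , zero
unpair (suc k) = next (unpair k)

unpair-onto : ∀ s m {n} → m + n ≡ s → ∃ λ k → unpair k ≡ (m , n)
unpair-onto zero    zero    {zero}  refl = zero , refl
unpair-onto zero    zero    {suc _} ()
unpair-onto (suc s) zero    refl = map suc (cong next) (unpair-onto s s (+-identityʳ s))
unpair-onto s       (suc m) {n} eq =
  map suc (cong next) (unpair-onto s m (trans (+-suc m n) eq))

-- Opaque, so that unification can read p and q off pair p ≡ pair q.
opaque
  pair : ℕ × ℕ → ℕ
  pair (m , n) = proj₁ (unpair-onto (m + n) m refl)

  unpair∘pair : ∀ p → unpair (pair p) ≡ p
  unpair∘pair (m , n) = proj₂ (unpair-onto (m + n) m refl)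

pair-injective : Injective _≡_ _≡_ pair
pair-injective {p} {q} e = begin
  p               ≡⟨ unpair∘pair p ⟨
  unpair (pair p) ≡⟨ cong unpair e ⟩
  unpair (pair q) ≡⟨ unpair∘pair q ⟩
  q               ∎
  where open ≡-Reasoning

module _ {T : Set} where

  index-injective : ∀ {xs : List T} {x y} (p : x ∈ xs) (q : y ∈ xs) → index p ≡ index q → x ≡ y
  index-injective {xs} {x} {y} p q e = begin
    x                   ≡⟨ lookup-index p ⟩
    lookup xs (index p) ≡⟨ cong (lookup xs) e ⟩
    lookup xs (index q) ≡⟨ lookup-index q ⟨
    y                   ∎
    where open ≡-Reasoning

  injective⇒≤-length : ∀ {m} {xs : List T} (h : Vector T m) → Injective _≡_ _≡_ h →
                       (∀ i → h i ∈ xs) → m ≤ length xs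
  injective⇒≤-length h h-inj h∈xs =
    injective⇒≤ (λ {i} {j} e → h-inj (index-injective (h∈xs i) (h∈xs j) e))

ℕ-countable : Countable ℕ
ℕ-countable = id , λ _ _ → id

Fin-countable : ∀ {n} → Countable (Fin n)
Fin-countable = toℕ , λ _ _ → toℕ-injective

Bool-countable : Countable Bool
Bool-countable = (λ b → if b then 1 else 0) , λ
  { false false _ → refl
  ; true  true  _ → refl
  ; false true  ()
  ; true  false ()
  }

countable-⋃-finite : ∀ {I T : Set} → Countable I → (xs : I → List T) →
                     (∀ t → ∃ λ i → t ∈ xs i) → Countable T
countable-⋃-finite (ι , ι-inj) xs cover =
  encode ∘ cover , λ s t → encode-injective (cover s) (cover t)
  where
  encode : ∀ {t} → ∃ (λ i → t ∈ xs i) → ℕ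
  encode (i , t∈) = pair (ι i , toℕ (index t∈))

  encode-injective : ∀ {s t} (s∈ : ∃ λ i → s ∈ xs i) (t∈ : ∃ λ i → t ∈ xs i) →
                     encode s∈ ≡ encode t∈ → s ≡ t
  encode-injective (i , s∈) (j , t∈) e with ι-inj i j (,-injectiveˡ (pair-injective e))
  ... | refl = index-injective s∈ t∈ (toℕ-injective (,-injectiveʳ (pair-injective e)))

CountableSubset : {T : Set} → (T → Set) → Set
CountableSubset {T} P = Σ (T → ℕ) λ f → ∀ x y → P x → P y → f x ≡ f y → x ≡ y

total⇒countable : ∀ {T : Set} {P : T → Set} → CountableSubset P → (∀ t → P t) → Countable T
total⇒countable (f , f-inj) total = f , λ x y → f-inj x y (total x) (total y)

module Classical (lem : ExcludedMiddle 0ℓ) where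

  dne : {P : Set} → ¬ ¬ P → P
  dne = decidable-stable lem

  module _ {T : Set} where

    countable-⊆ : {P Q : T → Set} → (∀ t → P t → Q t) →
                  CountableSubset Q → CountableSubset P
    countable-⊆ P⊆Q (f , f-inj) = f , λ x y Px Py → f-inj x y (P⊆Q x Px) (P⊆Q y Py)

    countable-∅ : CountableSubset {T} (λ _ → ⊥)
    countable-∅ = (λ _ → 0) , λ _ _ ()

    countable-singleton : (y : T) → CountableSubset (λ t → t ≡ y)
    countable-singleton y = (λ _ → 0) , λ _ _ x≡y z≡y _ → trans x≡y (sym z≡y)

    countable-⋃ : {I : Set} {P : I → T → Set} → Countable I → (∀ i → CountableSubset (P i)) →
                  CountableSubset (λ t → ∃ λ i → P i t)
    countable-⋃ {P = P} (ι , ι-inj) countable-P = code , code-injective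
      where
      code-by : (t : T) → Dec (∃ λ i → P i t) → ℕ
      code-by t (yes (i , _)) = pair (ι i , proj₁ (countable-P i) t)
      code-by t (no _)        = 0

      code : T → ℕ
      code t = code-by t lem

      code-injective : ∀ s t → ∃ (λ i → P i s) → ∃ (λ i → P i t) → code s ≡ code t → s ≡ t
      code-injective s t s∈ t∈ e with lem {∃ λ i → P i s} | lem {∃ λ i → P i t}
      ... | no s∉ | _     = contradiction s∈ s∉
      ... | _     | no t∉ = contradiction t∈ t∉
      ... | yes (i , Pis) | yes (j , Pjt) with ι-inj i j (,-injectiveˡ (pair-injective e))
      ...   | refl = proj₂ (countable-P i) s t Pis Pjt (,-injectiveʳ (pair-injective e))

    countable-∪ : {P Q : T → Set} → CountableSubset P → CountableSubset Q →
                  CountableSubset (λ t → P t ⊎ Q t)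
    countable-∪ {P} {Q} countable-P countable-Q =
      countable-⊆ tag (countable-⋃ Bool-countable λ { true → countable-P ; false → countable-Q })
      where
      tag : ∀ t → P t ⊎ Q t → ∃ λ b → if b then P t else Q t
      tag t (inj₁ Pt) = true , Pt
      tag t (inj₂ Qt) = false , Qt

    countable-⋃-∈ : {I : Set} {P : I → T → Set} (is : List I) → (∀ i → CountableSubset (P i)) →
                    CountableSubset (λ t → ∃ λ i → i ∈ is × P i t)
    countable-⋃-∈ {P = P} is countable-P =
      countable-⊆ (λ t (i , i∈ , Pit) → index i∈ , subst (λ i → P i t) (lookup-index i∈) Pit)
                  (countable-⋃ Fin-countable (countable-P ∘ lookup is))

    uncountable-⋃ : {I : Set} {P : I → T → Set} → Countable I →
                    ¬ CountableSubset (λ t → ∃ λ i → P i t) → ∃ λ i → ¬ CountableSubset (P i)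
    uncountable-⋃ {P = P} countable-I uncountable with lem {∃ λ i → ¬ CountableSubset (P i)}
    ... | yes found = found
    ... | no none   =
      contradiction (countable-⋃ countable-I λ i → dne λ ¬c → none (i , ¬c)) uncountable

    uncountable-∖-countable : {F C : T → Set} → ¬ CountableSubset F → CountableSubset C →
                              ∃ λ t → F t × ¬ C t
    uncountable-∖-countable {F} {C} uncountable countable-C with lem {∃ λ t → F t × ¬ C t}
    ... | yes found = found
    ... | no none   =
      contradiction (countable-⊆ (λ t Ft → dne λ ¬Ct → none (t , Ft , ¬Ct)) countable-C) uncountable

    image : ∀ {m} → Vector T m → Subset T
    image g t = does (lem {∃ λ i → g i ≡ t})

    image-intro : ∀ {m} (g : Vector T m) i → image g (g i) ≡ true
    image-intro g i = dec-true lem (i , refl)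

    image-elim : ∀ {m} (g : Vector T m) {t} → image g t ≡ true → ∃ λ i → g i ≡ t
    image-elim g {t} t∈ with lem {∃ λ i → g i ≡ t} | t∈
    ... | yes found | _ = found
    ... | no _      | ()

    image-two : ∀ {k} (g : Vector T (2 + k)) → Injective _≡_ _≡_ g → AtLeastTwo (image g)
    image-two g g-inj =
      g zero , g (suc zero) , 0≢1+n ∘ g-inj , image-intro g zero , image-intro g (suc zero)

  module FiniteDegreeGraph (G : BipGraph) (deg : ∀ a → FiniteDegree G a) where
    open BipGraph G

    L : A → List B
    L a = proj₁ (deg a)

    L-complete : ∀ {a b} → E a b ≡ true → b ∈ L a
    L-complete {a} {b} = proj₂ (deg a) b

    outside : List B → List B → ℕ
    outside R []      = 0
    outside R (c ∷ l) with lem {c ∈ R}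
    ... | yes _ = outside R l
    ... | no  _ = suc (outside R l)

    outside-∷-≤ : ∀ b R l → outside (b ∷ R) l ≤ outside R l
    outside-∷-≤ b R []      = z≤n
    outside-∷-≤ b R (c ∷ l) with lem {c ∈ b ∷ R} | lem {c ∈ R}
    ... | yes _    | yes _   = outside-∷-≤ b R l
    ... | yes _    | no _    = m≤n⇒m≤1+n (outside-∷-≤ b R l)
    ... | no c∉b∷R | yes c∈R = contradiction (there c∈R) c∉b∷R
    ... | no _     | no _    = s≤s (outside-∷-≤ b R l)

    outside-∷-< : ∀ R {b l} → b ∈ l → b ∉ R → outside (b ∷ R) l < outside R l
    outside-∷-< R {b} {_ ∷ l} (here refl) b∉R with lem {b ∈ b ∷ R} | lem {b ∈ R}
    ... | _        | yes b∈R = contradiction b∈R b∉R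
    ... | yes _    | no _    = s≤s (outside-∷-≤ b R l)
    ... | no b∉b∷R | no _    = contradiction (here refl) b∉b∷R
    outside-∷-< R {b} {c ∷ l} (there b∈l) b∉R with lem {c ∈ b ∷ R} | lem {c ∈ R}
    ... | yes _    | yes _   = outside-∷-< R b∈l b∉R
    ... | yes _    | no _    = m≤n⇒m≤1+n (outside-∷-< R b∈l b∉R)
    ... | no c∉b∷R | yes c∈R = contradiction (there c∈R) c∉b∷R
    ... | no _     | no _    = s≤s (outside-∷-< R b∈l b∉R)

    Neighbours : (A → Set) → B → A → Set
    Neighbours F b a = F a × E a b ≡ true

    CommonNeighbours⊆ : List B → A → A → Set
    CommonNeighbours⊆ R a a′ = ∀ {b} → E a b ≡ true → E a′ b ≡ true → b ∈ R

    IsSunflower : ∀ {m} → List B → Vector A m → Set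
    IsSunflower R g =
      Injective _≡_ _≡_ g × (∀ {i j} → i ≢ j → CommonNeighbours⊆ R (g i) (g j))

    Sunflower : List B → ℕ → Set
    Sunflower R m = Σ (Vector A m) (IsSunflower R)

    Blocked : ∀ {m} → List B → (A → Set) → Vector A m → A → Set
    Blocked R F g a = ∃ λ i → a ≡ g i ⊎ ∃ λ b → b ∈ L (g i) × b ∉ R × Neighbours F b a

    module _ {R : List B} {F : A → Set} where

      blocked-countable : (∀ b → b ∉ R → CountableSubset (Neighbours F b)) →
                          ∀ {m} (g : Vector A m) → CountableSubset (Blocked R F g)
      blocked-countable sparse g =
        countable-⋃ Fin-countable λ i →
          countable-∪ (countable-singleton (g i)) (countable-⋃-∈ (L (g i)) neighbours-outside-R)
        where
        neighbours-outside-R : ∀ b → CountableSubset (λ a → b ∉ R × Neighbours F b a)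
        neighbours-outside-R b with lem {b ∈ R}
        ... | yes b∈R = countable-⊆ (λ _ (b∉R , _) → contradiction b∈R b∉R) countable-∅
        ... | no b∉R  = countable-⊆ (λ _ → proj₂) (sparse b b∉R)

      sunflower-∷ : ∀ {m a} {g : Vector A m} → IsSunflower R g → F a → ¬ Blocked R F g a →
                    IsSunflower R (a ∷ᵛ g)
      sunflower-∷ {a = a} {g} (g-inj , g-common) Fa unblocked = ∷-injective , ∷-common
        where
        a≢g : ∀ i → a ≢ g i
        a≢g i a≡gi = unblocked (i , inj₁ a≡gi)

        a-common : ∀ j → CommonNeighbours⊆ R a (g j)
        a-common j ab gjb = dne λ b∉R → unblocked (j , inj₂ (_ , L-complete gjb , b∉R , Fa , ab))

        ∷-injective : Injective _≡_ _≡_ (a ∷ᵛ g)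
        ∷-injective {zero}  {zero}  _ = refl
        ∷-injective {zero}  {suc j} e = contradiction e (a≢g j)
        ∷-injective {suc i} {zero}  e = contradiction (sym e) (a≢g i)
        ∷-injective {suc i} {suc j} e = cong suc (g-inj e)

        ∷-common : ∀ {i j} → i ≢ j → CommonNeighbours⊆ R ((a ∷ᵛ g) i) ((a ∷ᵛ g) j)
        ∷-common {zero}  {zero}  i≢j = contradiction refl i≢j
        ∷-common {zero}  {suc j} _   = a-common j
        ∷-common {suc i} {zero}  _   = λ gib ab → a-common i ab gib
        ∷-common {suc i} {suc j} i≢j = g-common (i≢j ∘ cong suc)

      sparse⇒sunflower : ¬ CountableSubset F → (∀ b → b ∉ R → CountableSubset (Neighbours F b)) →
                         ∀ m → Sunflower R m
      sparse⇒sunflower _ _ zero = []ᵛ , (λ { {()} }) , (λ { {()} })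
      sparse⇒sunflower uncountable sparse (suc m) with sparse⇒sunflower uncountable sparse m
      ... | g , g-sunflower with uncountable-∖-countable uncountable (blocked-countable sparse g)
      ... | a , Fa , unblocked = a ∷ᵛ g , sunflower-∷ g-sunflower Fa unblocked

    uncountable⇒sunflower : ∀ n R {F} → ¬ CountableSubset F →
                            (∀ {a} → F a → outside R (L a) < n) →
                            ∃ λ R′ → ∀ m → Sunflower R′ m
    uncountable⇒sunflower zero R uncountable bound =
      contradiction (countable-⊆ (λ _ → n≮0 ∘ bound) countable-∅) uncountable
    uncountable⇒sunflower (suc n) R {F} uncountable bound
      with lem {∃ λ b → b ∉ R × ¬ CountableSubset (Neighbours F b)}
    ... | yes (b , b∉R , uncountable-b) =
      uncountable⇒sunflower n (b ∷ R) uncountable-b λ (Fa , ab) →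
        <-≤-trans (outside-∷-< R (L-complete ab) b∉R) (≤-pred (bound Fa))
    ... | no none =
      R , sparse⇒sunflower uncountable λ b b∉R →
            dne λ uncountable-b → none (b , b∉R , uncountable-b)

    N²-image⊆ : ∀ {m R} {g : Vector A m} →
                (∀ {i j} → i ≢ j → CommonNeighbours⊆ R (g i) (g j)) →
                ∀ {b} → InN2 G (image g) b → b ∈ R
    N²-image⊆ {g = g} common (x , y , x≢y , x∈ , y∈ , xb , yb)
      with image-elim g x∈ | image-elim g y∈
    ... | i , refl | j , refl = common (x≢y ∘ cong g) xb yb

    dHp⇒¬sunflower : ((X : Subset A) → AtLeastTwo X → N2CardGe G X) →
                     ∀ R → ¬ Sunflower R (2 + length R)
    dHp⇒¬sunflower dhp R (g , g-inj , common) with dhp (image g) (image-two g g-inj)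
    ... | f , f-inj , f∈N² =
      1+n≰n (m+n≤o⇒n≤o 1 (injective⇒≤-length (f ∘ member) f∘member-injective f∘member∈R))
      where
      member : Fin (2 + length R) → Elem (image g)
      member i = g i , image-intro g i

      f∘member-injective : Injective _≡_ _≡_ (f ∘ member)
      f∘member-injective {i} {j} e = g-inj (f-inj (member i) (member j) e)

      f∘member∈R : ∀ i → f (member i) ∈ R
      f∘member∈R i = N²-image⊆ common (f∈N² (member i))

    dHp⇒countable : IsDHp G → Countable A
    dHp⇒countable (_ , dhp) = dne λ ¬countable →
      let n , uncountable = uncountable-⋃ ℕ-countable (¬countable ∘ flip total⇒countable bounded)
          R , sunflower = uncountable⇒sunflower n [] uncountable id
      in dHp⇒¬sunflower dhp R (sunflower (2 + length R))
      where
      bounded : ∀ a → ∃ λ n → outside [] (L a) < n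
      bounded a = suc (outside [] (L a)) , ≤-refl

module _ (G : BipGraph) where
  open BipGraph G

  connected⇒neighbour : Connected G → A → ∀ b → ∃ λ a → E a b ≡ true
  connected⇒neighbour connected a₀ b with connected (inj₂ b) (inj₁ a₀)
  ... | _◅_ {j = inj₁ a} ba _ = a , ba

proposition2p2 : ExcludedMiddle 0ℓ → (G : BipGraph) →
    InfiniteType (BipGraph.A G ⊎ BipGraph.B G) →
    InfiniteType (BipGraph.A G) → InfiniteType (BipGraph.B G) →
    IsDHp G → ((a : BipGraph.A G) → FiniteDegree G a) →
    Countable (BipGraph.A G) × (Connected G → Countable (BipGraph.B G))
proposition2p2 lem G _ _ _ dHp deg = A-countable , B-countable
  where
  open BipGraph G using (A; B)
  open Classical lem
  open FiniteDegreeGraph G deg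

  A-countable : Countable A
  A-countable = dHp⇒countable dHp

  B-countable : Connected G → Countable B
  B-countable connected = countable-⋃-finite A-countable L λ b →
    map id L-complete (connected⇒neighbour G connected (proj₁ (proj₁ dHp)) b)
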